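{- For every even positive integer $D$ and every even positive integer $M\le 2^{\lceil D/9999\rceil}$, there exists an $(M,D)$-separator.
   Context: For even positive integers $M,D$, an $(M,D)$-separator is a sequence $(A_i,B_i)_{i=1}^D$ of bipartitions of $[M]$ (so $B_i=[M]\setminus A_i$) such that: (1) for each $i\in[D]$, $|A_i|=M/2$; (2) for all distinct $t,t'\in[M]$, $\left|\{i\in[D]: |\{t,t'\}\cap A_i|=1\}\right|\ge (\tfrac12-0.2)D$; (3) for each $t\in[M]$, $|\{i\in[D]: t\in A_i\}|=D/2$. -}

module Defs where

open import Data.Nat using (ℕ; _+_; _*_; _≤_; _/_)
open import Data.Nat.Divisibility using (_∣_)
open import Data.Fin using (Fin)
open import Data.Fin.Subset using (Subset; Side; inside; outside; ∣_∣)
open import Data.Vec using (lookup; tabulate)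
open import Data.Product using (_×_)
open import Relation.Binary.PropositionalEquality using (_≡_; _≢_)

exactlyOne : Side → Side → Side
exactlyOne inside  inside  = outside
exactlyOne inside  outside = inside
exactlyOne outside inside  = inside
exactlyOne outside outside = outside

-- A sequence of D bipartitions (A_i, [M] \ A_i) of [M] = Fin M is represented
-- by the sequence of the sets A_i : Subset M (B_i is its complement).
-- Number of i ∈ [D] with |{t,t'} ∩ A_i| = 1.
sepCount : ∀ {M D} → (Fin D → Subset M) → Fin M → Fin M → ℕ
sepCount A t t' = ∣ tabulate (λ i → exactlyOne (lookup (A i) t) (lookup (A i) t')) ∣

memCount : ∀ {M D} → (Fin D → Subset M) → Fin M → ℕ
memCount A t = ∣ tabulate (λ i → lookup (A i) t) ∣

-- (M,D)-separator.  Condition (2) with constant 0.2: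
-- count ≥ (1/2 - 0.2) D = 3D/10, stated exactly as 10 * count ≥ 3 * D.
IsSeparator : (M D : ℕ) → (Fin D → Subset M) → Set
IsSeparator M D A =
    (∀ i → ∣ A i ∣ ≡ M / 2)
  × (∀ t t' → t ≢ t' → 3 * D ≤ 10 * sepCount A t t')
  × (∀ t → memCount A t ≡ D / 2)

ceil9999 : ℕ → ℕ
ceil9999 n = (n + 9998) / 9999

-- Write D = 2L and M = 2Q. Greedily (Gilbert–Varshamov) choose Q words x_p ∈ {0,1}^L such that for
-- p ≠ p′ both x_p′ and its complement differ from x_p in at least 3L/10 coordinates: a Hamming ball of
-- radius 3L/10 has at most 3^L / 2^(7L/10) points, and since 3^10 ≤ 2^16 the 2Q balls around the words
-- chosen so far and their complements cannot cover {0,1}^L while 2Q ≤ 2^⌈D/9999⌉.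
-- The M points are the words x_p and their complements, and the D sets are indexed by a coordinate
-- j < L and a bit c: the set (j , c) contains the words w with w_j ≠ c. Each set then contains exactly
-- one of x_p and its complement, each point lies in exactly L sets, and two points are separated by
-- twice their Hamming distance.
module Submission where

open import Defs
open import Data.Bool using (Bool; true; false; not; _xor_)
open import Data.Bool.Properties
  using (xor-comm; xor-annihilates-not; not-distribˡ-xor; not-distribʳ-xor; xor-inverseʳ)
open import Data.Fin using (Fin; zero; suc; remQuot; combine)
open import Data.Fin.Properties using (combine-remQuot) renaming (_≟_ to _≟ᶠ_)
open import Data.Fin.Subset using (Subset; inside; outside; ∁; ⊤; ∣_∣)
open import Data.Fin.Subset.Properties using (∣∁p∣≡n∸∣p∣; ∣p∣≤n; ∣⊤∣≡n)
open import Data.Nat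
open import Data.Nat.DivMod using (m*n/n≡m; m/n*n≤m; m%n<n; m≡m%n+[m/n]*n)
open import Data.Nat.Divisibility using (_∣_; divides)
open import Data.Nat.Properties
open import Algebra.Properties.CommutativeSemigroup +-commutativeSemigroup using (interchange)
open import Data.Nat.Tactic.RingSolver using (solve-∀)
open import Data.Product using (Σ; ∃-syntax; _×_; _,_; proj₁; proj₂; uncurry)
open import Data.Vec using ([]; _∷_; lookup; tabulate; zipWith)
open import Data.Vec.Properties
  using (lookup∘tabulate; tabulate∘lookup; tabulate-cong; tabulate-∘; lookup-zipWith; lookup-map; zipWith-comm)
import Data.Vec.Functional as Vector
open import Function using (_∘_)
open import Relation.Binary.PropositionalEquality
open import Relation.Nullary using (Dec; yes; no; ¬_; contradiction)

private
  variable
    k m n : ℕ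

∣p∣+∣∁p∣≡n : (p : Subset n) → ∣ p ∣ + ∣ ∁ p ∣ ≡ n
∣p∣+∣∁p∣≡n p = trans (cong (∣ p ∣ +_) (∣∁p∣≡n∸∣p∣ p)) (m+[n∸m]≡n (∣p∣≤n p))

∣tabulate∣-remQuot : ∀ n (g : Fin n → Fin 2 → Bool) →
  ∣ tabulate (uncurry g ∘ remQuot 2) ∣ ≡ ∣ tabulate (λ i → g i zero) ∣ + ∣ tabulate (λ i → g i (suc zero)) ∣
∣tabulate∣-remQuot zero    g = refl
∣tabulate∣-remQuot (suc n) g with g zero zero | g zero (suc zero) | ∣tabulate∣-remQuot n (g ∘ suc)
... | true  | true  | ih = cong suc (trans (cong suc ih) (sym (+-suc _ _)))
... | true  | false | ih = cong suc ih
... | false | true  | ih = trans (cong suc ih) (sym (+-suc _ _))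
... | false | false | ih = ih

distance : Subset n → Subset n → ℕ
distance p q = ∣ zipWith _xor_ p q ∣

distance≡∣tabulate∣ : (p q : Subset n) → distance p q ≡ ∣ tabulate (λ i → lookup p i xor lookup q i) ∣
distance≡∣tabulate∣ p q = cong ∣_∣ (trans (sym (tabulate∘lookup (zipWith _xor_ p q))) (tabulate-cong (λ i → lookup-zipWith _xor_ i p q)))

distance-comm : (p q : Subset n) → distance p q ≡ distance q p
distance-comm p q = cong ∣_∣ (zipWith-comm xor-comm p q)

distance-∁-∁ : (p q : Subset n) → distance (∁ p) (∁ q) ≡ distance p q
distance-∁-∁ p q = cong ∣_∣ (go p q)
  where
  go : (p q : Subset n) → zipWith _xor_ (∁ p) (∁ q) ≡ zipWith _xor_ p q
  go []      []      = refl
  go (a ∷ p) (b ∷ q) = cong₂ _∷_ (xor-annihilates-not a b) (go p q)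

distance-∁ˡ : (p q : Subset n) → distance (∁ p) q ≡ distance p (∁ q)
distance-∁ˡ p q = cong ∣_∣ (go p q)
  where
  go : (p q : Subset n) → zipWith _xor_ (∁ p) q ≡ zipWith _xor_ p (∁ q)
  go []      []      = refl
  go (a ∷ p) (b ∷ q) = cong₂ _∷_ (trans (sym (not-distribˡ-xor a b)) (not-distribʳ-xor a b)) (go p q)

distance-∁ʳ-self : (p : Subset n) → distance p (∁ p) ≡ n
distance-∁ʳ-self {n} p = trans (cong ∣_∣ (go p)) (∣⊤∣≡n n)
  where
  go : (p : Subset k) → zipWith _xor_ p (∁ p) ≡ ⊤
  go []      = refl
  go (a ∷ p) = cong₂ _∷_ (xor-inverseʳ a) (go p)

Far : Subset n → Subset n → Set
Far {n} p q = 3 * n ≤ 10 * distance p q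

Far-resp : (p q p′ q′ : Subset n) → distance p q ≡ distance p′ q′ → Far p q → Far p′ q′
Far-resp {n} p q p′ q′ eq = subst (λ d → 3 * n ≤ 10 * d) eq

Far-∁ʳ-self : (p : Subset n) → Far p (∁ p)
Far-∁ʳ-self {n} p = subst (λ d → 3 * n ≤ 10 * d) (sym (distance-∁ʳ-self p)) (*-monoˡ-≤ n (≤ᵇ⇒≤ 3 10 _))

Apart : Subset n → Subset n → Set
Apart p q = Far p q × Far p (∁ q)

Apart-sym : {p q : Subset n} → Apart p q → Apart q p
Apart-sym {p = p} {q} (far , far∁) =
  Far-resp p q q p (distance-comm p q) far ,
  Far-resp p (∁ q) q (∁ p) (trans (sym (distance-∁ˡ p q)) (distance-comm (∁ p) q)) far∁

FarCode : (Fin m → Subset n) → Set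
FarCode x = ∀ p p′ → p ≢ p′ → Apart (x p) (x p′)

-- Separators from far codes

∁[_] : Fin 2 → Subset n → Subset n
∁[ zero ]     p = p
∁[ suc zero ] p = ∁ p

withComplements : (Fin m → Subset n) → Fin (m * 2) → Subset n
withComplements x = uncurry (λ p b → ∁[ b ] (x p)) ∘ remQuot 2

Far-∁[]-self : (p : Subset n) → ∀ {b b′} → b ≢ b′ → Far (∁[ b ] p) (∁[ b′ ] p)
Far-∁[]-self p {zero}     {zero}     b≢b′ = contradiction refl b≢b′
Far-∁[]-self p {zero}     {suc zero} _    = Far-∁ʳ-self p
Far-∁[]-self p {suc zero} {zero}     _    = Far-resp p (∁ p) (∁ p) p (distance-comm p (∁ p)) (Far-∁ʳ-self p)
Far-∁[]-self p {suc zero} {suc zero} b≢b′ = contradiction refl b≢b′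

Apart⇒Far-∁[] : {p q : Subset n} → Apart p q → ∀ b b′ → Far (∁[ b ] p) (∁[ b′ ] q)
Apart⇒Far-∁[]             (far , _)  zero       zero       = far
Apart⇒Far-∁[]             (_ , far∁) zero       (suc zero) = far∁
Apart⇒Far-∁[] {p = p} {q} (_ , far∁) (suc zero) zero       = Far-resp p (∁ q) (∁ p) q (sym (distance-∁ˡ p q)) far∁
Apart⇒Far-∁[] {p = p} {q} (far , _)  (suc zero) (suc zero) = Far-resp p q (∁ p) (∁ q) (sym (distance-∁-∁ p q)) far

withComplements-far : {x : Fin m → Subset n} → FarCode x →
                      ∀ t t′ → t ≢ t′ → Far (withComplements x t) (withComplements x t′)
withComplements-far {m} {x = x} code t t′ t≢t′ = far (remQuot 2 t) (remQuot 2 t′) (t≢t′ ∘ remQuot-injective)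
  where
  remQuot-injective : remQuot {m} 2 t ≡ remQuot 2 t′ → t ≡ t′
  remQuot-injective eq =
    trans (sym (combine-remQuot {m} 2 t)) (trans (cong (uncurry combine) eq) (combine-remQuot {m} 2 t′))
  far : ∀ r r′ → r ≢ r′ → Far (uncurry (λ p b → ∁[ b ] (x p)) r) (uncurry (λ p b → ∁[ b ] (x p)) r′)
  far (p , b) (p′ , b′) neq with p ≟ᶠ p′
  ... | yes refl = Far-∁[]-self (x p) (λ b≡b′ → neq (cong (p ,_) b≡b′))
  ... | no p≢p′  = Apart⇒Far-∁[] (code p p′ p≢p′) b b′

-- The coordinates of p and of ∁ p, interleaved: coordinate combine j c of balance p is lookup (∁[ c ] p) j.
balance : Subset n → Subset (n * 2)
balance p = tabulate (uncurry (λ j c → lookup (∁[ c ] p) j) ∘ remQuot 2)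

lookup-balance : (p : Subset n) (i : Fin (n * 2)) →
                 lookup (balance p) i ≡ uncurry (λ j c → lookup (∁[ c ] p) j) (remQuot 2 i)
lookup-balance {n} p = lookup∘tabulate (uncurry (λ j c → lookup (∁[ c ] p) j) ∘ remQuot {n} 2)

∣balance∣ : (p : Subset n) → ∣ balance p ∣ ≡ n
∣balance∣ {n} p = begin
  ∣ balance p ∣                                      ≡⟨ ∣tabulate∣-remQuot n (λ j c → lookup (∁[ c ] p) j) ⟩
  ∣ tabulate (lookup p) ∣ + ∣ tabulate (lookup (∁ p)) ∣ ≡⟨ cong₂ (λ u v → ∣ u ∣ + ∣ v ∣) (tabulate∘lookup p) (tabulate∘lookup (∁ p)) ⟩
  ∣ p ∣ + ∣ ∁ p ∣                                    ≡⟨ ∣p∣+∣∁p∣≡n p ⟩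
  n                                                  ∎
  where open ≡-Reasoning

distance-balance : (p q : Subset n) → distance (balance p) (balance q) ≡ distance p q + distance p q
distance-balance {n} p q = begin
  distance (balance p) (balance q)
    ≡⟨ distance≡∣tabulate∣ (balance p) (balance q) ⟩
  ∣ tabulate (λ i → lookup (balance p) i xor lookup (balance q) i) ∣
    ≡⟨ cong ∣_∣ (tabulate-cong (λ i → cong₂ _xor_ (lookup-balance p i) (lookup-balance q i))) ⟩
  ∣ tabulate (uncurry (λ j c → lookup (∁[ c ] p) j xor lookup (∁[ c ] q) j) ∘ remQuot 2) ∣
    ≡⟨ ∣tabulate∣-remQuot n (λ j c → lookup (∁[ c ] p) j xor lookup (∁[ c ] q) j) ⟩
  ∣ tabulate (λ j → lookup p j xor lookup q j) ∣ + ∣ tabulate (λ j → lookup (∁ p) j xor lookup (∁ q) j) ∣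
    ≡⟨ cong₂ _+_ (sym (distance≡∣tabulate∣ p q)) (sym (distance≡∣tabulate∣ (∁ p) (∁ q))) ⟩
  distance p q + distance (∁ p) (∁ q)
    ≡⟨ cong (distance p q +_) (distance-∁-∁ p q) ⟩
  distance p q + distance p q
    ∎
  where open ≡-Reasoning

lookup-balance-∁ : (p : Subset n) (i : Fin (n * 2)) → lookup (balance (∁ p)) i ≡ not (lookup (balance p) i)
lookup-balance-∁ p i = begin
  lookup (balance (∁ p)) i                            ≡⟨ lookup-balance (∁ p) i ⟩
  uncurry (λ j c → lookup (∁[ c ] (∁ p)) j) (remQuot 2 i) ≡⟨ complemented (remQuot 2 i) ⟩
  not (uncurry (λ j c → lookup (∁[ c ] p) j) (remQuot 2 i)) ≡⟨ cong not (lookup-balance p i) ⟨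
  not (lookup (balance p) i)                          ∎
  where
  open ≡-Reasoning
  complemented : ∀ r → uncurry (λ j c → lookup (∁[ c ] (∁ p)) j) r ≡ not (uncurry (λ j c → lookup (∁[ c ] p) j) r)
  complemented (j , zero)     = lookup-map j not p
  complemented (j , suc zero) = lookup-map j not (∁ p)

rows : (Fin m → Subset k) → Fin k → Subset m
rows cols i = tabulate (λ t → lookup (cols t) i)

memCount-rows : (cols : Fin m → Subset k) (t : Fin m) → memCount (rows cols) t ≡ ∣ cols t ∣
memCount-rows cols t =
  cong ∣_∣ (trans (tabulate-cong (λ i → lookup∘tabulate _ t)) (tabulate∘lookup (cols t)))

exactlyOne≗xor : ∀ a b → exactlyOne a b ≡ a xor b
exactlyOne≗xor true  true  = refl
exactlyOne≗xor true  false = refl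
exactlyOne≗xor false true  = refl
exactlyOne≗xor false false = refl

sepCount-rows : (cols : Fin m → Subset k) (t t′ : Fin m) → sepCount (rows cols) t t′ ≡ distance (cols t) (cols t′)
sepCount-rows cols t t′ =
  trans (cong ∣_∣ (tabulate-cong entry)) (sym (distance≡∣tabulate∣ (cols t) (cols t′)))
  where
  entry : ∀ i → exactlyOne (lookup (rows cols i) t) (lookup (rows cols i) t′) ≡ lookup (cols t) i xor lookup (cols t′) i
  entry i = trans (exactlyOne≗xor _ _)
                  (cong₂ _xor_ (lookup∘tabulate (λ s → lookup (cols s) i) t) (lookup∘tabulate (λ s → lookup (cols s) i) t′))

∣rows∣-withComplements : (x : Fin m → Subset n) (i : Fin (n * 2)) → ∣ rows (balance ∘ withComplements x) i ∣ ≡ m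
∣rows∣-withComplements {m} x i = begin
  ∣ rows (balance ∘ withComplements x) i ∣                     ≡⟨ ∣tabulate∣-remQuot m (λ p b → lookup (balance (∁[ b ] (x p))) i) ⟩
  ∣ r ∣ + ∣ tabulate (λ p → lookup (balance (∁ (x p))) i) ∣    ≡⟨ cong (λ v → ∣ r ∣ + ∣ v ∣) r∁ ⟩
  ∣ r ∣ + ∣ ∁ r ∣                                             ≡⟨ ∣p∣+∣∁p∣≡n r ⟩
  m                                                          ∎
  where
  open ≡-Reasoning
  r = tabulate (λ p → lookup (balance (x p)) i)
  r∁ : tabulate (λ p → lookup (balance (∁ (x p))) i) ≡ ∁ r
  r∁ = trans (tabulate-cong (λ p → lookup-balance-∁ (x p) i)) (tabulate-∘ not _)

balanced-separator : (x : Fin m → Subset n) → FarCode x →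
                     IsSeparator (m * 2) (n * 2) (rows (balance ∘ withComplements x))
balanced-separator {m} {n} x code =
  (λ i → trans (∣rows∣-withComplements x i) (sym (m*n/n≡m m 2))) ,
  (λ t t′ t≢t′ → separated t t′ (withComplements-far {x = x} code t t′ t≢t′)) ,
  (λ t → trans (memCount-rows (balance ∘ y) t) (trans (∣balance∣ (y t)) (sym (m*n/n≡m n 2))))
  where
  y = withComplements x
  separated : ∀ t t′ → Far (y t) (y t′) → 3 * (n * 2) ≤ 10 * sepCount (rows (balance ∘ y)) t t′
  separated t t′ far = begin
    3 * (n * 2)                      ≡⟨ double-3 n ⟩
    3 * n + 3 * n                    ≤⟨ +-mono-≤ far far ⟩
    10 * d + 10 * d                  ≡⟨ *-distribˡ-+ 10 d d ⟨
    10 * (d + d)                     ≡⟨ cong (10 *_) (sym (trans (sepCount-rows (balance ∘ y) t t′) (distance-balance (y t) (y t′)))) ⟩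
    10 * sepCount (rows (balance ∘ y)) t t′ ∎
    where
    open ≤-Reasoning
    d = distance (y t) (y t′)
    double-3 : ∀ n → 3 * (n * 2) ≡ 3 * n + 3 * n
    double-3 = solve-∀

sumSubsets : ∀ n → (Subset n → ℕ) → ℕ
sumSubsets zero    f = f []
sumSubsets (suc n) f = sumSubsets n (f ∘ (inside ∷_)) + sumSubsets n (f ∘ (outside ∷_))

sumSubsets-mono-≤ : ∀ n {f g : Subset n → ℕ} → (∀ p → f p ≤ g p) → sumSubsets n f ≤ sumSubsets n g
sumSubsets-mono-≤ zero    f≤g = f≤g []
sumSubsets-mono-≤ (suc n) f≤g = +-mono-≤ (sumSubsets-mono-≤ n (f≤g ∘ (inside ∷_))) (sumSubsets-mono-≤ n (f≤g ∘ (outside ∷_)))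

sumSubsets-distrib-+ : ∀ n (f g : Subset n → ℕ) → sumSubsets n (λ p → f p + g p) ≡ sumSubsets n f + sumSubsets n g
sumSubsets-distrib-+ zero    f g = refl
sumSubsets-distrib-+ (suc n) f g = begin
  sumSubsets n (λ p → f (inside ∷ p) + g (inside ∷ p)) + sumSubsets n (λ p → f (outside ∷ p) + g (outside ∷ p))
    ≡⟨ cong₂ _+_ (sumSubsets-distrib-+ n _ _) (sumSubsets-distrib-+ n _ _) ⟩
  (sumSubsets n (f ∘ (inside ∷_)) + sumSubsets n (g ∘ (inside ∷_))) + (sumSubsets n (f ∘ (outside ∷_)) + sumSubsets n (g ∘ (outside ∷_)))
    ≡⟨ interchange (sumSubsets n (f ∘ (inside ∷_))) (sumSubsets n (g ∘ (inside ∷_)))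
                   (sumSubsets n (f ∘ (outside ∷_))) (sumSubsets n (g ∘ (outside ∷_))) ⟩
  sumSubsets (suc n) f + sumSubsets (suc n) g
    ∎
  where open ≡-Reasoning

sumSubsets-*ˡ : ∀ n c (f : Subset n → ℕ) → sumSubsets n (λ p → c * f p) ≡ c * sumSubsets n f
sumSubsets-*ˡ zero    c f = refl
sumSubsets-*ˡ (suc n) c f =
  trans (cong₂ _+_ (sumSubsets-*ˡ n c _) (sumSubsets-*ˡ n c _)) (sym (*-distribˡ-+ c _ _))

sumSubsets-xor : ∀ n (q : Subset n) (f : Subset n → ℕ) → sumSubsets n (λ p → f (zipWith _xor_ p q)) ≡ sumSubsets n f
sumSubsets-xor zero    []            f = refl
sumSubsets-xor (suc n) (outside ∷ q) f =
  cong₂ _+_ (sumSubsets-xor n q (f ∘ (inside ∷_))) (sumSubsets-xor n q (f ∘ (outside ∷_)))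
sumSubsets-xor (suc n) (inside ∷ q)  f =
  trans (cong₂ _+_ (sumSubsets-xor n q (f ∘ (outside ∷_))) (sumSubsets-xor n q (f ∘ (inside ∷_))))
        (+-comm (sumSubsets n (f ∘ (outside ∷_))) (sumSubsets n (f ∘ (inside ∷_))))

sumSubsets-2^∣∁p∣ : ∀ n → sumSubsets n (λ p → 2 ^ ∣ ∁ p ∣) ≡ 3 ^ n
sumSubsets-2^∣∁p∣ zero    = refl
sumSubsets-2^∣∁p∣ (suc n) =
  trans (cong₂ _+_ (sumSubsets-2^∣∁p∣ n) (sumSubsets-*ˡ n 2 (λ p → 2 ^ ∣ ∁ p ∣)))
        (cong (λ s → 3 ^ n + 2 * s) (sumSubsets-2^∣∁p∣ n))

sumSubsets<2^n⇒∃≡0 : ∀ n (f : Subset n → ℕ) → sumSubsets n f < 2 ^ n → ∃[ p ] f p ≡ 0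
sumSubsets<2^n⇒∃≡0 zero    f f[]<1 = [] , n<1⇒n≡0 f[]<1
sumSubsets<2^n⇒∃≡0 (suc n) f sum<2^1+n with sumSubsets n (f ∘ (inside ∷_)) <? 2 ^ n
... | yes insides<2^n = let p , fp≡0 = sumSubsets<2^n⇒∃≡0 n _ insides<2^n in inside ∷ p , fp≡0
... | no  insides≮2^n = let p , fp≡0 = sumSubsets<2^n⇒∃≡0 n _ outsides<2^n in outside ∷ p , fp≡0
  where
  outsides<2^n : sumSubsets n (f ∘ (outside ∷_)) < 2 ^ n
  outsides<2^n = +-cancelˡ-< (2 ^ n) _ _ (begin-strict
    2 ^ n + sumSubsets n (f ∘ (outside ∷_)) ≤⟨ +-monoˡ-≤ _ (≮⇒≥ insides≮2^n) ⟩
    sumSubsets (suc n) f                     <⟨ sum<2^1+n ⟩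
    2 * 2 ^ n                               ≡⟨ cong (2 ^ n +_) (+-identityʳ (2 ^ n)) ⟩
    2 ^ n + 2 ^ n                           ∎)
    where open ≤-Reasoning

indicator : {P : Set} → Dec P → ℕ
indicator (yes _) = 1
indicator (no _)  = 0

*-indicator-≤ : {P : Set} (d : Dec P) {a b : ℕ} → (P → a ≤ b) → a * indicator d ≤ b
*-indicator-≤ (yes x) {a} {b} a≤b = subst (_≤ b) (sym (*-identityʳ a)) (a≤b x)
*-indicator-≤ (no _)  {a} {b} _   = subst (_≤ b) (sym (*-zeroʳ a)) z≤n

indicator≡0⇒¬ : {P : Set} (d : Dec P) → indicator d ≡ 0 → ¬ P
indicator≡0⇒¬ (no ¬x) _ = ¬x

light : Subset n → ℕ
light {n} p = indicator (10 * ∣ p ∣ <? 3 * n)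

volume : ℕ → ℕ
volume n = sumSubsets n light

light≡0⇒heavy : (p : Subset n) → light p ≡ 0 → 3 * n ≤ 10 * ∣ p ∣
light≡0⇒heavy p eq = ≮⇒≥ (indicator≡0⇒¬ _ eq)

light⇒≤∣∁p∣ : ∀ {q} (p : Subset n) → 10 * q ≤ 7 * n → 10 * ∣ p ∣ < 3 * n → q ≤ ∣ ∁ p ∣
light⇒≤∣∁p∣ {n} {q} p 10q≤7n isLight = *-cancelˡ-≤ 10 (<⇒≤ (+-cancelʳ-< (10 * ∣ p ∣) _ _ (begin-strict
  10 * q + 10 * ∣ p ∣           <⟨ +-mono-≤-< 10q≤7n isLight ⟩
  7 * n + 3 * n                 ≡⟨ split n ⟩
  10 * n                        ≡⟨ cong (10 *_) (∣p∣+∣∁p∣≡n p) ⟨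
  10 * (∣ p ∣ + ∣ ∁ p ∣)         ≡⟨ *-distribˡ-+ 10 ∣ p ∣ ∣ ∁ p ∣ ⟩
  10 * ∣ p ∣ + 10 * ∣ ∁ p ∣      ≡⟨ +-comm (10 * ∣ p ∣) _ ⟩
  10 * ∣ ∁ p ∣ + 10 * ∣ p ∣      ∎)))
  where
  open ≤-Reasoning
  split : ∀ n → 7 * n + 3 * n ≡ 10 * n
  split = solve-∀

-- Weighting each subset p by 2 ^ ∣ ∁ p ∣ sums to 3 ^ n, and light subsets carry weight at least 2 ^ q.
volume-bound : ∀ n q → 10 * q ≤ 7 * n → 2 ^ q * volume n ≤ 3 ^ n
volume-bound n q 10q≤7n = begin
  2 ^ q * volume n                        ≡⟨ sumSubsets-*ˡ n (2 ^ q) light ⟨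
  sumSubsets n (λ p → 2 ^ q * light p)    ≤⟨ sumSubsets-mono-≤ n weight ⟩
  sumSubsets n (λ p → 2 ^ ∣ ∁ p ∣)        ≡⟨ sumSubsets-2^∣∁p∣ n ⟩
  3 ^ n                                   ∎
  where
  open ≤-Reasoning
  weight : ∀ p → 2 ^ q * light p ≤ 2 ^ ∣ ∁ p ∣
  weight p = *-indicator-≤ (10 * ∣ p ∣ <? 3 * n) {2 ^ q} (^-monoʳ-≤ 2 ∘ light⇒≤∣∁p∣ {q = q} p 10q≤7n)

-- Far codes by the greedy algorithm

nearness : (Fin m → Subset n) → Subset n → ℕ
nearness {zero}  x p = 0
nearness {suc m} x p =
  light (zipWith _xor_ p (x zero)) + light (zipWith _xor_ p (∁ (x zero))) + nearness (x ∘ suc) p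

sumSubsets-nearness : (x : Fin m → Subset n) → sumSubsets n (nearness x) ≡ m * (volume n + volume n)
sumSubsets-nearness {zero}  {n} x = sumSubsets-*ˡ n 0 (λ _ → 0)
sumSubsets-nearness {suc m} {n} x = begin
  sumSubsets n (nearness x)
    ≡⟨ sumSubsets-distrib-+ n _ (nearness (x ∘ suc)) ⟩
  sumSubsets n (λ p → light (zipWith _xor_ p (x zero)) + light (zipWith _xor_ p (∁ (x zero))))
    + sumSubsets n (nearness (x ∘ suc))
    ≡⟨ cong₂ _+_ (sumSubsets-distrib-+ n _ _) (sumSubsets-nearness (x ∘ suc)) ⟩
  sumSubsets n (λ p → light (zipWith _xor_ p (x zero))) + sumSubsets n (λ p → light (zipWith _xor_ p (∁ (x zero))))
    + m * (volume n + volume n)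
    ≡⟨ cong (_+ m * (volume n + volume n))
            (cong₂ _+_ (sumSubsets-xor n (x zero) light) (sumSubsets-xor n (∁ (x zero)) light)) ⟩
  suc m * (volume n + volume n)
    ∎
  where open ≡-Reasoning

nearness≡0⇒Apart : (x : Fin m → Subset n) (p : Subset n) → nearness x p ≡ 0 → ∀ i → Apart p (x i)
nearness≡0⇒Apart x p eq zero =
  light≡0⇒heavy d (m+n≡0⇒m≡0 (light d) near≡0) , light≡0⇒heavy d∁ (m+n≡0⇒n≡0 (light d) near≡0)
  where
  d  = zipWith _xor_ p (x zero)
  d∁ = zipWith _xor_ p (∁ (x zero))
  near≡0 = m+n≡0⇒m≡0 (light d + light d∁) eq
nearness≡0⇒Apart x p eq (suc i) = nearness≡0⇒Apart (x ∘ suc) p (m+n≡0⇒n≡0 near₀ eq) i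
  where near₀ = light (zipWith _xor_ p (x zero)) + light (zipWith _xor_ p (∁ (x zero)))

-- Gilbert–Varshamov: a word avoiding the balls around all x i and ∁ (x i) exists while they cannot cover every word.
farCode : ∀ n m → (∀ k → k < m → k * (volume n + volume n) < 2 ^ n) → Σ (Fin m → Subset n) FarCode
farCode n zero    _      = (λ ()) , (λ ())
farCode n (suc m) budget = w Vector.∷ x , code′
  where
  previous = farCode n m (λ k k<m → budget k (m<n⇒m<1+n k<m))
  x = proj₁ previous
  fresh = sumSubsets<2^n⇒∃≡0 n (nearness x) (subst (_< 2 ^ n) (sym (sumSubsets-nearness x)) (budget m (n<1+n m)))
  w = proj₁ fresh
  apart = nearness≡0⇒Apart x w (proj₂ fresh)
  code′ : FarCode (w Vector.∷ x)
  code′ zero    zero     0≢0 = contradiction refl 0≢0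
  code′ zero    (suc i′) _   = apart i′
  code′ (suc i) zero     _   = Apart-sym {p = w} {x i} (apart i)
  code′ (suc i) (suc i′) i≢i′ = proj₂ previous i i′ (i≢i′ ∘ cong suc)

3^n≤2^[15+16*[n/10]] : ∀ n → 3 ^ n ≤ 2 ^ (15 + 16 * (n / 10))
3^n≤2^[15+16*[n/10]] n = begin
  3 ^ n                                  ≡⟨ cong (3 ^_) (m≡m%n+[m/n]*n n 10) ⟩
  3 ^ (n % 10 + n / 10 * 10)             ≡⟨ ^-distribˡ-+-* 3 (n % 10) (n / 10 * 10) ⟩
  3 ^ (n % 10) * 3 ^ (n / 10 * 10)       ≡⟨ cong (λ e → 3 ^ (n % 10) * 3 ^ e) (*-comm (n / 10) 10) ⟩
  3 ^ (n % 10) * 3 ^ (10 * (n / 10))     ≡⟨ cong (3 ^ (n % 10) *_) (^-*-assoc 3 10 (n / 10)) ⟨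
  3 ^ (n % 10) * (3 ^ 10) ^ (n / 10)     ≤⟨ *-mono-≤ 3^[n%10]≤2^15 (^-monoˡ-≤ (n / 10) (≤ᵇ⇒≤ (3 ^ 10) (2 ^ 16) _)) ⟩
  2 ^ 15 * (2 ^ 16) ^ (n / 10)           ≡⟨ cong (2 ^ 15 *_) (^-*-assoc 2 16 (n / 10)) ⟩
  2 ^ 15 * 2 ^ (16 * (n / 10))           ≡⟨ ^-distribˡ-+-* 2 15 (16 * (n / 10)) ⟨
  2 ^ (15 + 16 * (n / 10))               ∎
  where
  open ≤-Reasoning
  3^[n%10]≤2^15 : 3 ^ (n % 10) ≤ 2 ^ 15
  3^[n%10]≤2^15 = ≤-trans (^-monoʳ-≤ 3 (≤-pred (m%n<n n 10))) (≤ᵇ⇒≤ (3 ^ 9) (2 ^ 15) _)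

ceil9999-small : ∀ n → 2 ≤ ceil9999 (n * 2) → 10 * ceil9999 (n * 2) + 150 ≤ n
ceil9999-small n 2≤K = *-cancelʳ-≤ (10 * ceil9999 (n * 2) + 150) n 2 (begin
  (10 * K + 150) * 2      ≡⟨ double K ⟩
  20 * K + 150 * 2        ≤⟨ +-monoʳ-≤ (20 * K) (*-monoʳ-≤ 150 2≤K) ⟩
  20 * K + 150 * K        ≡⟨ collect K ⟩
  K * 170                 ≤⟨ *-monoʳ-≤ K (≤ᵇ⇒≤ 170 5000 _) ⟩
  K * 5000                ≤⟨ +-cancelʳ-≤ (K * 4999) (K * 5000) (n * 2) K*9999≤ ⟩
  n * 2                   ∎)
  where
  open ≤-Reasoning
  K = ceil9999 (n * 2)
  K*9999≤ : K * 5000 + K * 4999 ≤ n * 2 + K * 4999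
  K*9999≤ = begin
    K * 5000 + K * 4999   ≡⟨ *-distribˡ-+ K 5000 4999 ⟨
    K * 9999              ≤⟨ m/n*n≤m (n * 2 + 9998) 9999 ⟩
    n * 2 + 2 * 4999      ≤⟨ +-monoʳ-≤ (n * 2) (*-monoˡ-≤ 4999 2≤K) ⟩
    n * 2 + K * 4999      ∎
  double : ∀ K → (10 * K + 150) * 2 ≡ 20 * K + 150 * 2
  double = solve-∀
  collect : ∀ K → 20 * K + 150 * K ≡ K * 170
  collect = solve-∀

2^K*3^n≤2^n*2^[7*[n/10]] : ∀ n K → 10 * K + 150 ≤ n → 2 ^ K * 3 ^ n ≤ 2 ^ n * 2 ^ (7 * (n / 10))
2^K*3^n≤2^n*2^[7*[n/10]] n K small = begin
  2 ^ K * 3 ^ n                    ≤⟨ *-monoʳ-≤ (2 ^ K) (3^n≤2^[15+16*[n/10]] n) ⟩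
  2 ^ K * 2 ^ (15 + 16 * a)        ≡⟨ ^-distribˡ-+-* 2 K (15 + 16 * a) ⟨
  2 ^ (K + (15 + 16 * a))          ≤⟨ ^-monoʳ-≤ 2 exponent ⟩
  2 ^ (n + 7 * a)                  ≡⟨ ^-distribˡ-+-* 2 n (7 * a) ⟩
  2 ^ n * 2 ^ (7 * a)              ∎
  where
  open ≤-Reasoning
  a = n / 10
  exponent : K + (15 + 16 * a) ≤ n + 7 * a
  exponent = *-cancelˡ-≤ 10 (begin
    10 * (K + (15 + 16 * a))               ≡⟨ regroup K a ⟩
    (10 * K + 150) + 9 * (a * 10) + 70 * a ≤⟨ +-monoˡ-≤ (70 * a) (+-mono-≤ small (*-monoʳ-≤ 9 (m/n*n≤m n 10))) ⟩
    n + 9 * n + 70 * a                     ≡⟨ ungroup n a ⟩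
    10 * (n + 7 * a)                       ∎)
    where
    regroup : ∀ K a → 10 * (K + (15 + 16 * a)) ≡ (10 * K + 150) + 9 * (a * 10) + 70 * a
    regroup = solve-∀
    ungroup : ∀ n a → n + 9 * n + 70 * a ≡ 10 * (n + 7 * a)
    ungroup = solve-∀

greedy-budget : ∀ n Q → Q * 2 ≤ 2 ^ ceil9999 (n * 2) → ∀ k → k < Q → k * (volume n + volume n) < 2 ^ n
greedy-budget n Q Q*2≤2^K zero    _   = m^n>0 2 n
greedy-budget n Q Q*2≤2^K (suc k) k<Q = *-cancelʳ-< (2 ^ q) (suc k * (volume n + volume n)) (2 ^ n) (begin-strict
  suc k * (volume n + volume n) * 2 ^ q ≡⟨ regroup (suc k) (volume n) (2 ^ q) ⟩
  (suc k * 2) * (2 ^ q * volume n)      ≤⟨ *-monoʳ-≤ (suc k * 2) (volume-bound n q 10q≤7n) ⟩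
  (suc k * 2) * 3 ^ n                   <⟨ *-monoˡ-< (3 ^ n) {{m^n≢0 3 n}} (<-≤-trans (*-monoˡ-< 2 k<Q) Q*2≤2^K) ⟩
  2 ^ K * 3 ^ n                         ≤⟨ 2^K*3^n≤2^n*2^[7*[n/10]] n K (ceil9999-small n 2≤K) ⟩
  2 ^ n * 2 ^ q                         ∎)
  where
  open ≤-Reasoning
  K = ceil9999 (n * 2)
  q = 7 * (n / 10)
  10q≤7n : 10 * q ≤ 7 * n
  10q≤7n = subst (_≤ 7 * n) (reorder (n / 10)) (*-monoʳ-≤ 7 (m/n*n≤m n 10))
    where
    reorder : ∀ a → 7 * (a * 10) ≡ 10 * (7 * a)
    reorder = solve-∀
  -- k ≥ 1 forces Q ≥ 2, hence K ≥ 2, which makes n ≥ 5000 large enough for the arithmetic.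
  2≤K : 2 ≤ K
  2≤K = ≮⇒≥ λ K<2 → <⇒≱ (^-monoʳ-< 2 (≤ᵇ⇒≤ 2 2 _) K<2) (≤-trans (*-monoˡ-≤ 2 (≤-trans (s≤s (s≤s z≤n)) k<Q)) Q*2≤2^K)
  regroup : ∀ m v x → m * (v + v) * x ≡ (m * 2) * (x * v)
  regroup = solve-∀

lemma2p2 : (D M : ℕ) → NonZero D → 2 ∣ D → NonZero M → 2 ∣ M
         → M ≤ 2 ^ ceil9999 D
         → Σ (Fin D → Subset M) (λ A → IsSeparator M D A)
lemma2p2 .(L * 2) .(Q * 2) _ (divides L refl) _ (divides Q refl) M≤2^K =
  let x , code = farCode L Q (greedy-budget L Q M≤2^K)
  in rows (balance ∘ withComplements x) , balanced-separator x code
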